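{- Let $n\ge1$ and $j\in[n]$, and let $T$ be a placement of points in a grid with $n$ columns and $2n$ rows such that each column contains at most two points, each row contains at most one point, each of the rows $1,\dots,j-1$ contains exactly one point and that point $(j':i')$ satisfies $i'\ge j'$, and each of the columns $1,\dots,j-1$ contains exactly two points. Let $I$ be the set of $i\in[j,2n]$ such that the boxes $(1:i),\dots,(j-1:i)$ are empty. For $i\in I$ define the sequence $\mathcal{I}_T(j:i)=(i_0,i_1,\dots)$ by $i_0=i$ and, for $k\ge0$: if $i_k\in[j,2n-j]\cup\{2n\}$ then $i_{k+1}=i_k$; if $i_k\in[2n-j+1,2n-1]$ then $i_{k+1}$ is the row of the upper point of column $2n-i_k$; if $i_k\in[1,j-1]$ then $i_{k+1}$ is the row of the lower point of column $i_k$. Then for each $i\in I$ the sequence $\mathcal{I}_T(j:i)$ is eventually constant, with eventual value $\mathrm{root}_T(j:i)\in[j,2n-j]\cup\{2n\}$, and the map $i\mapsto \mathrm{root}_T(j:i)$ is a bijection from $I$ onto $[j,2n-j]\cup\{2n\}$.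
   Context: Columns are numbered $1,\dots,n$ from left to right, rows $1,\dots,2n$ from bottom to top, and $(j:i)$ denotes the box (or point) in column $j$ and row $i$. In a column with two points, the one with larger row index is the upper point and the other the lower point. For integers $a\le b$, $[a,b]=\{a,\dots,b\}$ (empty if $a>b$) and $[n]=[1,n]$. -}

module Defs where

open import Data.Nat using (ℕ; zero; suc; _+_; _*_; _∸_; _≤_; _<_; _≤ᵇ_; _<ᵇ_)
open import Data.Bool using (Bool; true; false; if_then_else_; _∧_)
open import Data.List using (List; []; _∷_; map; upTo)
open import Data.Product using (_×_; Σ; ∃)
open import Data.Sum using (_⊎_)
open import Relation.Binary.PropositionalEquality using (_≡_)

-- A placement: P c r = true iff there is a point in box (c : r)
-- (column c, row r, both 1-based).
Placement : Set
Placement = ℕ → ℕ → Bool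

countTrue : List Bool → ℕ
countTrue []            = 0
countTrue (true ∷ bs)   = suc (countTrue bs)
countTrue (false ∷ bs)  = countTrue bs

rowsOf : ℕ → List ℕ
rowsOf n = map suc (upTo (2 * n))

colsOf : ℕ → List ℕ
colsOf n = map suc (upTo n)

colCount : ℕ → Placement → ℕ → ℕ
colCount n P c = countTrue (map (λ r → P c r) (rowsOf n))

rowCount : ℕ → Placement → ℕ → ℕ
rowCount n P r = countTrue (map (λ c → P c r) (colsOf n))

InGrid : ℕ → Placement → Set
InGrid n P = ∀ c r → P c r ≡ true → (1 ≤ c × c ≤ n) × (1 ≤ r × r ≤ 2 * n)

maxRow : Placement → ℕ → ℕ → ℕ
maxRow P c zero    = 0
maxRow P c (suc k) = if P c (suc k) then suc k else maxRow P c k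

minRowFrom : Placement → ℕ → ℕ → ℕ → ℕ
minRowFrom P c r zero    = 0
minRowFrom P c r (suc k) = if P c r then r else minRowFrom P c (suc r) k

-- row of the upper / lower point of column c (meaningful when column c has two points)
upperRow : ℕ → Placement → ℕ → ℕ
upperRow n P c = maxRow P c (2 * n)

lowerRow : ℕ → Placement → ℕ → ℕ
lowerRow n P c = minRowFrom P c 1 (2 * n)

step : ℕ → ℕ → Placement → ℕ → ℕ
step n j P i =
  if (1 ≤ᵇ i) ∧ (i <ᵇ j) then lowerRow n P i
  else if ((2 * n ∸ j + 1) ≤ᵇ i) ∧ (i <ᵇ 2 * n) then upperRow n P (2 * n ∸ i)
  else i

iter : (ℕ → ℕ) → ℕ → ℕ → ℕ
iter f zero    x = x
iter f (suc k) x = f (iter f k x)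

seqI : ℕ → ℕ → Placement → ℕ → ℕ → ℕ
seqI n j P i k = iter (step n j P) k i

Hyp : ℕ → ℕ → Placement → Set
Hyp n j P =
  InGrid n P
  × (∀ c → 1 ≤ c → c ≤ n → colCount n P c ≤ 2)
  × (∀ r → 1 ≤ r → r ≤ 2 * n → rowCount n P r ≤ 1)
  × (∀ r → 1 ≤ r → r < j → rowCount n P r ≡ 1 × (∀ c → P c r ≡ true → c ≤ r))
  × (∀ c → 1 ≤ c → c < j → colCount n P c ≡ 2)

InI : ℕ → ℕ → Placement → ℕ → Set
InI n j P i = (j ≤ i × i ≤ 2 * n) × (∀ c → 1 ≤ c → c < j → P c i ≡ false)

InRoots : ℕ → ℕ → ℕ → Set
InRoots n j r = (j ≤ r × r ≤ 2 * n ∸ j) ⊎ r ≡ 2 * n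

module Submission where

-- The sequence I_T(j:·) iterates one map f = step n j P.  Call a row x
-- moving if x ∈ [1, j-1] ∪ [2n-j+1, 2n-1]; exactly there f is non-trivial, and it maps the
-- moving rows injectively onto the rows occupied by the points of the full columns
-- 1, …, j-1 (row x < j goes to the lower point of column x, row x ≥ 2n-j+1 to the upper
-- point of column 2n-x).  For any such partial injection f of [1, N], the orbit of a
-- point outside the image of f cannot revisit a point while it is moving, so by pigeonhole
-- it stops moving within N steps; hence x ↦ f^N x maps the non-image points injectively
-- to the non-moving points, and running the same argument for the inverse of f shows
-- that it is onto.

open import Defs
open import Data.Nat using (ℕ; zero; suc; _+_; _*_; _∸_; _≤_; _<_; _≤′_; ≤′-refl; ≤′-step; pred; z≤n; s≤s; s≤s⁻¹; _≤?_; _<?_; >-nonZero)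
open import Data.Nat.Properties
open import Data.Bool using (Bool; true; false; if_then_else_; _∧_; T)
open import Data.Bool.Properties using () renaming (_≟_ to _≟ᵇ_)
open import Data.Unit using (tt)
open import Data.List using ([]; _∷_; [_]; _++_; _∷ʳ_; map; upTo)
open import Data.List.Properties using (map-++; upTo-∷ʳ)
open import Data.Product using (_×_; Σ; ∃; _,_; proj₁; proj₂)
open import Data.Sum using (_⊎_; inj₁; inj₂)
open import Data.Empty using (⊥; ⊥-elim)
open import Data.Fin using (Fin; toℕ; fromℕ<)
open import Data.Fin.Properties using (pigeonhole; toℕ-fromℕ<; toℕ≤pred[n])
open import Relation.Nullary using (¬_; yes; no; contradiction)
open import Relation.Nullary.Decidable using (map′; _×-dec_; _⊎-dec_)
open import Relation.Unary using (Decidable)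
open import Relation.Binary using (tri<; tri≈; tri>)
open import Relation.Binary.PropositionalEquality using (_≡_; _≢_; refl; sym; trans; cong; subst; module ≡-Reasoning)

InRange : ℕ → ℕ → Set
InRange N x = 1 ≤ x × x ≤ N

if-true : ∀ {A : Set} {b : Bool} {x y : A} → b ≡ true → (if b then x else y) ≡ x
if-true refl = refl

if-false : ∀ {A : Set} {b : Bool} {x y : A} → b ≡ false → (if b then x else y) ≡ y
if-false refl = refl

∧-true : ∀ {a b : Bool} → T a → T b → a ∧ b ≡ true
∧-true {true} {true} _ _ = refl

∧-false : ∀ {a b : Bool} → (T a → T b → ⊥) → a ∧ b ≡ false
∧-false {true}  {true}  never = ⊥-elim (never tt tt)
∧-false {true}  {false} _     = refl
∧-false {false}         _     = refl

-- Counting.  count b m is the number of x ∈ [1, m] with b x = true; the column and row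
-- counts of Defs are instances of it: colCount n P c = count (P c) (2 * n) and
-- rowCount n P r = count (λ c → P c r) n.

count : (ℕ → Bool) → ℕ → ℕ
count b m = countTrue (map b (map suc (upTo m)))

countTrue-++ : ∀ bs cs → countTrue (bs ++ cs) ≡ countTrue bs + countTrue cs
countTrue-++ []           cs = refl
countTrue-++ (true ∷ bs)  cs = cong suc (countTrue-++ bs cs)
countTrue-++ (false ∷ bs) cs = countTrue-++ bs cs

count-suc : ∀ b m → count b (suc m) ≡ countTrue [ b (suc m) ] + count b m
count-suc b m = begin
  count b (suc m)
    ≡⟨ cong (λ xs → countTrue (map b (map suc xs))) (sym (upTo-∷ʳ m)) ⟩
  countTrue (map b (map suc (upTo m ∷ʳ m)))
    ≡⟨ cong (λ xs → countTrue (map b xs)) (map-++ suc (upTo m) [ m ]) ⟩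
  countTrue (map b (map suc (upTo m) ∷ʳ suc m))
    ≡⟨ cong countTrue (map-++ b (map suc (upTo m)) [ suc m ]) ⟩
  countTrue (map b (map suc (upTo m)) ∷ʳ b (suc m))
    ≡⟨ countTrue-++ (map b (map suc (upTo m))) [ b (suc m) ] ⟩
  count b m + countTrue [ b (suc m) ]
    ≡⟨ +-comm (count b m) _ ⟩
  countTrue [ b (suc m) ] + count b m ∎
  where open ≡-Reasoning

count-hit : ∀ b m → b (suc m) ≡ true → count b (suc m) ≡ suc (count b m)
count-hit b m hit = trans (count-suc b m) (cong (λ v → countTrue [ v ] + count b m) hit)

count-miss : ∀ b m → b (suc m) ≡ false → count b (suc m) ≡ count b m
count-miss b m miss = trans (count-suc b m) (cong (λ v → countTrue [ v ] + count b m) miss)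

count-mono : ∀ b {m m'} → m ≤ m' → count b m ≤ count b m'
count-mono b m≤m' = go (≤⇒≤′ m≤m')
  where
  go : ∀ {m m'} → m ≤′ m' → count b m ≤ count b m'
  go ≤′-refl        = ≤-refl
  go (≤′-step {k} p) = ≤-trans (go p) (≤-trans (m≤n+m (count b k) _) (≤-reflexive (sym (count-suc b k))))

count-point : ∀ b {y m} → b (suc y) ≡ true → suc y ≤ m → suc (count b y) ≤ count b m
count-point b {y} hit y<m = ≤-trans (≤-reflexive (sym (count-hit b y hit))) (count-mono b y<m)

count-two : ∀ b {x y m} → 1 ≤ x → x < y → y ≤ m → b x ≡ true → b y ≡ true → 2 ≤ count b m
count-two b {suc x} {suc y} _ (s≤s x<y) y≤m bx by =
  ≤-trans (s≤s (≤-trans (s≤s z≤n) (count-point b bx x<y))) (count-point b by y≤m)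

count-three : ∀ b {x y z m} → 1 ≤ x → x < y → y < z → z ≤ m →
  b x ≡ true → b y ≡ true → b z ≡ true → 3 ≤ count b m
count-three b {z = suc z} 1≤x x<y (s≤s y≤z) z≤m bx by bz =
  ≤-trans (s≤s (count-two b 1≤x x<y y≤z bx by)) (count-point b bz z≤m)

count-witness : ∀ b m → 1 ≤ count b m → ∃ λ x → InRange m x × b x ≡ true
count-witness b zero ()
count-witness b (suc m) pos with b (suc m) in hit
... | true  = suc m , (s≤s z≤n , ≤-refl) , hit
... | false =
  let x , (1≤x , x≤m) , bx = count-witness b m (≤-trans pos (≤-reflexive (count-miss b m hit)))
  in  x , (1≤x , m≤n⇒m≤1+n x≤m) , bx

count-pair : ∀ b m → 2 ≤ count b m →
  ∃ λ x → ∃ λ y → 1 ≤ x × x < y × y ≤ m × b x ≡ true × b y ≡ true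
count-pair b zero ()
count-pair b (suc m) two with b (suc m) in hit
... | true =
  let x , (1≤x , x≤m) , bx = count-witness b m (s≤s⁻¹ (≤-trans two (≤-reflexive (count-hit b m hit))))
  in  x , suc m , 1≤x , s≤s x≤m , ≤-refl , bx , hit
... | false =
  let x , y , 1≤x , x<y , y≤m , bx , by = count-pair b m (≤-trans two (≤-reflexive (count-miss b m hit)))
  in  x , y , 1≤x , x<y , m≤n⇒m≤1+n y≤m , bx , by

count-unique : ∀ b m {x y} → count b m ≤ 1 → InRange m x → InRange m y →
  b x ≡ true → b y ≡ true → x ≡ y
count-unique b m {x} {y} atMostOne (1≤x , x≤m) (1≤y , y≤m) bx by with <-cmp x y
... | tri< x<y _ _ = contradiction (count-two b 1≤x x<y y≤m bx by) (<⇒≱ (s≤s atMostOne))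
... | tri≈ _ x≡y _ = x≡y
... | tri> _ _ y<x = contradiction (count-two b 1≤y y<x x≤m by bx) (<⇒≱ (s≤s atMostOne))

minRowFrom-least : ∀ P c r k {u} → r ≤ u → u < r + k → P c u ≡ true →
  P c (minRowFrom P c r k) ≡ true × r ≤ minRowFrom P c r k × minRowFrom P c r k ≤ u
minRowFrom-least P c r zero {u} r≤u u<r+0 _ =
  contradiction (≤-trans u<r+0 (≤-reflexive (+-identityʳ r))) (≤⇒≯ r≤u)
minRowFrom-least P c r (suc k) {u} r≤u u<r+k pu with P c r in pr
... | true  = pr , ≤-refl , r≤u
... | false with m≤n⇒m<n∨m≡n r≤u
...   | inj₂ refl = contradiction (trans (sym pr) pu) λ ()
...   | inj₁ r<u =
  let pm , 1+r≤m , m≤u = minRowFrom-least P c (suc r) k r<u (≤-trans u<r+k (≤-reflexive (+-suc r k))) pu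
  in  pm , ≤-trans (n≤1+n r) 1+r≤m , m≤u

maxRow-greatest : ∀ P c k {u} → 1 ≤ u → u ≤ k → P c u ≡ true →
  P c (maxRow P c k) ≡ true × u ≤ maxRow P c k × maxRow P c k ≤ k
maxRow-greatest P c zero    1≤u u≤0 _ = contradiction u≤0 (<⇒≱ 1≤u)
maxRow-greatest P c (suc k) {u} 1≤u u≤k pu with P c (suc k) in pk
... | true  = pk , u≤k , ≤-refl
... | false with m≤n⇒m<n∨m≡n u≤k
...   | inj₂ refl = contradiction (trans (sym pk) pu) λ ()
...   | inj₁ u<1+k =
  let pm , u≤m , m≤k = maxRow-greatest P c k 1≤u (s≤s⁻¹ u<1+k) pu
  in  pm , u≤m , m≤n⇒m≤1+n m≤k

record TwoPointColumn (n : ℕ) (P : Placement) (c : ℕ) : Set where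
  field
    lower<upper : lowerRow n P c < upperRow n P c
    lower-point : P c (lowerRow n P c) ≡ true
    upper-point : P c (upperRow n P c) ≡ true
    only-points : ∀ {u} → InRange (2 * n) u → P c u ≡ true →
                  u ≡ lowerRow n P c ⊎ u ≡ upperRow n P c

two-point-column : ∀ n P c → colCount n P c ≡ 2 → TwoPointColumn n P c
two-point-column n P c two with count-pair (P c) (2 * n) (≤-reflexive (sym two))
... | x , y , 1≤x , x<y , y≤2n , px , py = record
  { lower<upper = ≤-<-trans lower≤x (<-≤-trans x<y y≤upper)
  ; lower-point = lower-point
  ; upper-point = upper-point
  ; only-points = only-points
  }
  where
  lower upper : ℕ
  lower = lowerRow n P c
  upper = upperRow n P c

  lower-least : ∀ {u} → InRange (2 * n) u → P c u ≡ true → P c lower ≡ true × 1 ≤ lower × lower ≤ u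
  lower-least (1≤u , u≤2n) = minRowFrom-least P c 1 (2 * n) 1≤u (s≤s u≤2n)

  upper-greatest : ∀ {u} → InRange (2 * n) u → P c u ≡ true → P c upper ≡ true × u ≤ upper × upper ≤ 2 * n
  upper-greatest (1≤u , u≤2n) = maxRow-greatest P c (2 * n) 1≤u u≤2n

  x-in : InRange (2 * n) x
  x-in = 1≤x , ≤-trans (<⇒≤ x<y) y≤2n

  y-in : InRange (2 * n) y
  y-in = ≤-trans 1≤x (<⇒≤ x<y) , y≤2n

  lower-point : P c lower ≡ true
  lower-point = proj₁ (lower-least x-in px)

  upper-point : P c upper ≡ true
  upper-point = proj₁ (upper-greatest y-in py)

  lower≤x : lower ≤ x
  lower≤x = proj₂ (proj₂ (lower-least x-in px))

  y≤upper : y ≤ upper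
  y≤upper = proj₁ (proj₂ (upper-greatest y-in py))

  -- a third point strictly between lower and upper would make the count at least three
  only-points : ∀ {u} → InRange (2 * n) u → P c u ≡ true → u ≡ lower ⊎ u ≡ upper
  only-points {u} u-in pu with u ≟ lower | u ≟ upper
  ... | yes u≡lower | _           = inj₁ u≡lower
  ... | no _        | yes u≡upper = inj₂ u≡upper
  ... | no u≢lower  | no u≢upper  =
    let _ , 1≤lower , lower≤u = lower-least u-in pu
        _ , u≤upper , upper≤2n = upper-greatest u-in pu
        three = count-three (P c) 1≤lower (≤∧≢⇒< lower≤u (λ eq → u≢lower (sym eq)))
                  (≤∧≢⇒< u≤upper u≢upper) upper≤2n lower-point pu upper-point
    in  contradiction (subst (3 ≤_) two three) λ { (s≤s (s≤s ())) }

pigeonhole-ℕ : ∀ N (φ : ℕ → ℕ) → (∀ t → t ≤ N → InRange N (φ t)) →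
  ∃ λ p → ∃ λ q → p < q × q ≤ N × φ p ≡ φ q
pigeonhole-ℕ N φ range =
  let p , q , p<q , same = pigeonhole (n<1+n N) slot
  in  toℕ p , toℕ q , p<q , toℕ≤pred[n] q ,
      pred-injective {{>-nonZero (proj₁ (range-at p))}} {{>-nonZero (proj₁ (range-at q))}}
        (trans (sym (toℕ-fromℕ< (below p))) (trans (cong toℕ same) (toℕ-fromℕ< (below q))))
  where
  range-at : (t : Fin (suc N)) → InRange N (φ (toℕ t))
  range-at t = range (toℕ t) (toℕ≤pred[n] t)

  below : (t : Fin (suc N)) → pred (φ (toℕ t)) < N
  below t with φ (toℕ t) | range-at t
  ... | suc v | _ , 1+v≤N = 1+v≤N

  slot : Fin (suc N) → Fin N
  slot t = fromℕ< (below t)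

first-failure : ∀ {P : ℕ → Set} → Decidable P → ∀ k →
  (∀ t → t < k → P t) ⊎ ∃ λ a → a < k × (∀ t → t < a → P t) × ¬ P a
first-failure P? zero = inj₁ λ _ ()
first-failure {P} P? (suc k) with first-failure P? k
... | inj₂ (a , a<k , before , fails) = inj₂ (a , m≤n⇒m≤1+n a<k , before , fails)
... | inj₁ before with P? k
...   | no fails  = inj₂ (k , ≤-refl , before , fails)
...   | yes holds = inj₁ λ t t<1+k → case (m<1+n⇒m<n∨m≡n t<1+k)
  where
  case : ∀ {t} → t < k ⊎ t ≡ k → P t
  case (inj₁ t<k) = before _ t<k
  case (inj₂ refl) = holds

iter-suc-inner : ∀ (f : ℕ → ℕ) k x → iter f (suc k) x ≡ iter f k (f x)
iter-suc-inner f zero    x = refl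
iter-suc-inner f (suc k) x = cong f (iter-suc-inner f k x)

iter-cancel : ∀ (f g : ℕ → ℕ) {D : ℕ → Set} → (∀ {u} → D u → f (g u) ≡ u) →
  ∀ b r → (∀ t → t < b → D (iter g t r)) → iter f b (iter g b r) ≡ r
iter-cancel f g cancel zero    r _  = refl
iter-cancel f g cancel (suc b) r inD = begin
  iter f (suc b) (g (iter g b r))  ≡⟨ iter-suc-inner f b _ ⟩
  iter f b (f (g (iter g b r)))    ≡⟨ cong (iter f b) (cancel (inD b ≤-refl)) ⟩
  iter f b (iter g b r)            ≡⟨ iter-cancel f g cancel b r (λ t t<b → inD t (m≤n⇒m≤1+n t<b)) ⟩
  r                                ∎
  where open ≡-Reasoning

module Orbits (N : ℕ) (f : ℕ → ℕ) {Active Start : ℕ → Set} (active? : Decidable Active)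
  (f-injective : ∀ {x y} → Active x → Active y → f x ≡ f y → x ≡ y)
  (f-fixes : ∀ {x} → ¬ Active x → f x ≡ x)
  (f-range : ∀ {x} → InRange N x → InRange N (f x))
  (start-range : ∀ {x} → Start x → InRange N x)
  (start-unreached : ∀ {x y} → Start x → Active y → f y ≢ x) where

  orbit : ℕ → ℕ → ℕ
  orbit x t = iter f t x

  ActiveBefore : ℕ → ℕ → Set
  ActiveBefore x a = ∀ t → t < a → Active (orbit x t)

  orbit-range : ∀ {x} → Start x → ∀ t → InRange N (orbit x t)
  orbit-range sx zero    = start-range sx
  orbit-range sx (suc t) = f-range (orbit-range sx t)

  -- If two orbits meet after moving a resp. b times, then peeling off steps by
  -- injectivity reaches a start point on both sides at once: a = b and x = y.
  orbit-meet : ∀ a b {x y} → Start x → Start y → ActiveBefore x a → ActiveBefore y b →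
    orbit x a ≡ orbit y b → a ≡ b × x ≡ y
  orbit-meet zero    zero    _  _  _    _    x≡y = refl , x≡y
  orbit-meet zero    (suc b) sx _  _    acty eq  = contradiction (sym eq) (start-unreached sx (acty b ≤-refl))
  orbit-meet (suc a) zero    _  sy actx _    eq  = contradiction eq (start-unreached sy (actx a ≤-refl))
  orbit-meet (suc a) (suc b) sx sy actx acty eq  =
    let a≡b , x≡y = orbit-meet a b sx sy (earlier actx) (earlier acty)
                      (f-injective (actx a ≤-refl) (acty b ≤-refl) eq)
    in  cong suc a≡b , x≡y
    where
    earlier : ∀ {z c} → ActiveBefore z (suc c) → ActiveBefore z c
    earlier act t t<c = act t (m≤n⇒m≤1+n t<c)

  -- An orbit that moved N + 1 times would repeat a value (pigeonhole), contradicting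
  -- orbit-meet; so it reaches an inactive point within N steps.
  exit : ∀ {x} → Start x → ∃ λ a → a ≤ N × ActiveBefore x a × ¬ Active (orbit x a)
  exit {x} sx with first-failure (λ t → active? (orbit x t)) (suc N)
  ... | inj₂ (a , a<1+N , before , stop) = a , s≤s⁻¹ a<1+N , before , stop
  ... | inj₁ always =
    let p , q , p<q , q≤N , same = pigeonhole-ℕ N (orbit x) (λ t _ → orbit-range sx t)
        below-q : ∀ t → t < q → t < suc N
        below-q t t<q = <-≤-trans t<q (m≤n⇒m≤1+n q≤N)
        p≡q , _ = orbit-meet p q sx sx (λ t t<p → always t (below-q t (<-trans t<p p<q)))
                    (λ t t<q → always t (below-q t t<q)) same
    in  contradiction p≡q (<⇒≢ p<q)

  settled : ∀ {x a} → ¬ Active (orbit x a) → ∀ k → a ≤ k → orbit x k ≡ orbit x a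
  settled {x} {a} stop k a≤k = go (≤⇒≤′ a≤k)
    where
    go : ∀ {k} → a ≤′ k → orbit x k ≡ orbit x a
    go ≤′-refl     = refl
    go (≤′-step p) = trans (cong f (go p)) (f-fixes stop)

-- A partial injection f of [1, N]: a bijection from the active points onto the image
-- points, extended by the identity.
module PartialBijection (N : ℕ) (f : ℕ → ℕ) {Active Image : ℕ → Set}
  (active? : Decidable Active) (image? : Decidable Image)
  (active-range : ∀ {x} → Active x → InRange N x)
  (image-range : ∀ {u} → Image u → InRange N u)
  (f-injective : ∀ {x y} → Active x → Active y → f x ≡ f y → x ≡ y)
  (f-into : ∀ {x} → Active x → Image (f x))
  (f-onto : ∀ {u} → Image u → ∃ λ x → Active x × f x ≡ u)
  (f-fixes : ∀ {x} → ¬ Active x → f x ≡ x) where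

  Source Sink : ℕ → Set
  Source x = InRange N x × ¬ Image x
  Sink   x = InRange N x × ¬ Active x

  f-range : ∀ {x} → InRange N x → InRange N (f x)
  f-range {x} x-in with active? x
  ... | yes act  = image-range (f-into act)
  ... | no  ¬act = subst (InRange N) (sym (f-fixes ¬act)) x-in

  f⁻¹ : ℕ → ℕ
  f⁻¹ u with image? u
  ... | yes im = proj₁ (f-onto im)
  ... | no  _  = u

  f⁻¹-active : ∀ {u} → Image u → Active (f⁻¹ u)
  f⁻¹-active {u} im with image? u
  ... | yes im′ = proj₁ (proj₂ (f-onto im′))
  ... | no  ¬im = contradiction im ¬im

  f∘f⁻¹ : ∀ {u} → Image u → f (f⁻¹ u) ≡ u
  f∘f⁻¹ {u} im with image? u
  ... | yes im′ = proj₂ (proj₂ (f-onto im′))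
  ... | no  ¬im = contradiction im ¬im

  f⁻¹-fixes : ∀ {u} → ¬ Image u → f⁻¹ u ≡ u
  f⁻¹-fixes {u} ¬im with image? u
  ... | yes im = contradiction im ¬im
  ... | no  _  = refl

  f⁻¹-range : ∀ {u} → InRange N u → InRange N (f⁻¹ u)
  f⁻¹-range {u} u-in with image? u
  ... | yes im = active-range (proj₁ (proj₂ (f-onto im)))
  ... | no  _  = u-in

  f⁻¹-injective : ∀ {u v} → Image u → Image v → f⁻¹ u ≡ f⁻¹ v → u ≡ v
  f⁻¹-injective imu imv eq = trans (sym (f∘f⁻¹ imu)) (trans (cong f eq) (f∘f⁻¹ imv))

  module Forward = Orbits N f {Start = Source} active? f-injective f-fixes f-range proj₁
    (λ (_ , ¬im) act eq → ¬im (subst Image eq (f-into act)))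
  module Backward = Orbits N f⁻¹ {Start = Sink} image? f⁻¹-injective f⁻¹-fixes f⁻¹-range proj₁
    (λ (_ , ¬act) im eq → ¬act (subst Active eq (f⁻¹-active im)))

  root : ℕ → ℕ
  root x = iter f N x

  root-settles : ∀ {x} → Source x → ∀ k → N ≤ k → iter f k x ≡ root x
  root-settles sx k N≤k =
    let a , a≤N , _ , stop = Forward.exit sx
    in  trans (Forward.settled stop k (≤-trans a≤N N≤k)) (sym (Forward.settled stop N a≤N))

  root-sink : ∀ {x} → Source x → Sink (root x)
  root-sink sx =
    let a , a≤N , _ , stop = Forward.exit sx
    in  Forward.orbit-range sx N , λ act → stop (subst Active (Forward.settled stop N a≤N) act)

  root-injective : ∀ {x y} → Source x → Source y → root x ≡ root y → x ≡ y
  root-injective sx sy eq =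
    let a , a≤N , actx , stopx = Forward.exit sx
        b , b≤N , acty , stopy = Forward.exit sy
    in  proj₂ (Forward.orbit-meet a b sx sy actx acty
          (trans (sym (Forward.settled stopx N a≤N)) (trans eq (Forward.settled stopy N b≤N))))

  -- Walk back from a sink r with f⁻¹ until leaving the image; the point reached is a
  -- source whose forward orbit retraces the walk and stops at r.
  root-onto : ∀ {r} → Sink r → ∃ λ x → Source x × root x ≡ r
  root-onto {r} sr =
    let b , b≤N , inImage , stop = Backward.exit sr
        x = Backward.orbit r b
        back : iter f b x ≡ r
        back = iter-cancel f f⁻¹ f∘f⁻¹ b r inImage
    in  x , (Backward.orbit-range sr b , stop) ,
        trans (Forward.settled (λ act → proj₂ sr (subst Active back act)) N b≤N) back

module Tableau (n j : ℕ) (1≤j : 1 ≤ j) (j≤n : j ≤ n) (P : Placement) (hyp : Hyp n j P) where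

  N : ℕ
  N = 2 * n

  in-grid : InGrid n P
  in-grid = proj₁ hyp

  row-at-most-one : ∀ r → 1 ≤ r → r ≤ N → rowCount n P r ≤ 1
  row-at-most-one = proj₁ (proj₂ (proj₂ hyp))

  early-rows : ∀ r → 1 ≤ r → r < j → rowCount n P r ≡ 1 × (∀ c → P c r ≡ true → c ≤ r)
  early-rows = proj₁ (proj₂ (proj₂ (proj₂ hyp)))

  full-columns : ∀ c → 1 ≤ c → c < j → colCount n P c ≡ 2
  full-columns = proj₂ (proj₂ (proj₂ (proj₂ hyp)))

  j≤N : j ≤ N
  j≤N = ≤-trans j≤n (m≤m+n n (n + 0))

  -- Early numbers are also exactly the full columns.
  Early Late Moving : ℕ → Set
  Early x  = 1 ≤ x × x < j
  Late x   = N ∸ j < x × x < N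
  Moving x = Early x ⊎ Late x

  moving? : Decidable Moving
  moving? x = ((1 ≤? x) ×-dec (x <? j)) ⊎-dec ((N ∸ j <? x) ×-dec (x <? N))

  early≤N : ∀ {x} → Early x → x ≤ N
  early≤N (_ , x<j) = ≤-trans (<⇒≤ x<j) j≤N

  moving-range : ∀ {x} → Moving x → InRange N x
  moving-range (inj₁ early@(1≤x , _))  = 1≤x , early≤N early
  moving-range (inj₂ (N∸j<x , x<N)) = ≤-trans (s≤s z≤n) N∸j<x , <⇒≤ x<N

  late-column : ∀ {x} → Late x → Early (N ∸ x)
  late-column {x} (N∸j<x , x<N) = m<n⇒0<n∸m x<N , m<n+o⇒m∸n<o N x {{>-nonZero 1≤j}} N<x+j
    where
    N<x+j : N < x + j
    N<x+j = <-≤-trans (≤-reflexive (cong suc (sym (m∸n+n≡m j≤N)))) (+-monoˡ-< j N∸j<x)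

  column-late : ∀ {c} → Early c → Late (N ∸ c)
  column-late {c} (1≤c , c<j) = ∸-monoʳ-< c<j j≤N , ∸-monoʳ-< 1≤c (≤-trans (<⇒≤ c<j) j≤N)

  early-not-late : ∀ {x} → Early x → ¬ Late x
  early-not-late (_ , x<j) (N∸j<x , _) = <⇒≱ x<j (≤-trans j≤N∸j (<⇒≤ N∸j<x))
    where
    j≤N∸j : j ≤ N ∸ j
    j≤N∸j = ≤-trans j≤n (≤-trans (≤-reflexive (sym (trans (m+n∸m≡n n (n + 0)) (+-identityʳ n)))) (∸-monoʳ-≤ N j≤n))

  f : ℕ → ℕ
  f = step n j P

  step-early : ∀ {x} → Early x → f x ≡ lowerRow n P x
  step-early (1≤x , x<j) = if-true (∧-true (≤⇒≤ᵇ 1≤x) (<⇒<ᵇ x<j))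

  step-late : ∀ {x} → Late x → f x ≡ upperRow n P (N ∸ x)
  step-late {x} late@(N∸j<x , x<N) =
    trans (if-false (∧-false λ 1≤x x<j → early-not-late (≤ᵇ⇒≤ 1 x 1≤x , <ᵇ⇒< x j x<j) late))
          (if-true (∧-true (≤⇒≤ᵇ (subst (_≤ x) (+-comm 1 (N ∸ j)) N∸j<x)) (<⇒<ᵇ x<N)))

  step-still : ∀ {x} → ¬ Moving x → f x ≡ x
  step-still {x} still =
    trans (if-false (∧-false λ 1≤x x<j → still (inj₁ (≤ᵇ⇒≤ 1 x 1≤x , <ᵇ⇒< x j x<j))))
          (if-false (∧-false λ N∸j+1≤x x<N →
             still (inj₂ (subst (_≤ x) (+-comm (N ∸ j) 1) (≤ᵇ⇒≤ (N ∸ j + 1) x N∸j+1≤x) , <ᵇ⇒< x N x<N))))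

  column : ∀ {c} → Early c → TwoPointColumn n P c
  column {c} (1≤c , c<j) = two-point-column n P c (full-columns c 1≤c c<j)

  same-row : ∀ {c c' r} → P c r ≡ true → P c' r ≡ true → c ≡ c'
  same-row {c} {c'} {r} pc pc' =
    let c-in , 1≤r , r≤N = in-grid c r pc
        c'-in , _ = in-grid c' r pc'
    in  count-unique (λ d → P d r) n (row-at-most-one r 1≤r r≤N) c-in c'-in pc pc'

  -- The image of the step: rows carrying a point of one of the full columns.
  Occupied : ℕ → Set
  Occupied u = ∃ λ c → Early c × P c u ≡ true

  occupied? : Decidable Occupied
  occupied? u = map′ (λ (c , c<j , 1≤c , pcu) → c , (1≤c , c<j) , pcu)
                     (λ (c , (1≤c , c<j) , pcu) → c , c<j , 1≤c , pcu)
                     (anyUpTo? (λ c → (1 ≤? c) ×-dec (P c u ≟ᵇ true)) j)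

  occupied-range : ∀ {u} → Occupied u → InRange N u
  occupied-range {u} (c , _ , pcu) = proj₂ (in-grid c u pcu)

  target-column : ∀ {x} → Moving x → ℕ
  target-column {x} (inj₁ _) = x
  target-column {x} (inj₂ _) = N ∸ x

  target-column-full : ∀ {x} (m : Moving x) → Early (target-column m)
  target-column-full (inj₁ early) = early
  target-column-full (inj₂ late)  = late-column late

  target-point : ∀ {x} (m : Moving x) → P (target-column m) (f x) ≡ true
  target-point {x} (inj₁ early) =
    subst (λ r → P x r ≡ true) (sym (step-early early)) (TwoPointColumn.lower-point (column early))
  target-point {x} (inj₂ late)  =
    subst (λ r → P (N ∸ x) r ≡ true) (sym (step-late late)) (TwoPointColumn.upper-point (column (late-column late)))

  step-into : ∀ {x} → Moving x → Occupied (f x)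
  step-into m = target-column m , target-column-full m , target-point m

  same-target : ∀ {x y} (mx : Moving x) (my : Moving y) → f x ≡ f y → target-column mx ≡ target-column my
  same-target mx my fx≡fy =
    same-row (target-point mx) (subst (λ r → P (target-column my) r ≡ true) (sym fx≡fy) (target-point my))

  -- An early and a late row sent into the same column hit its lower and its upper point,
  -- which differ.
  early-late-apart : ∀ {x y} → Early x → Late y → f x ≢ f y
  early-late-apart {x} {y} ex ly fx≡fy =
    contradiction lower≡upper (<⇒≢ (TwoPointColumn.lower<upper (column ex)))
    where
    open ≡-Reasoning
    lower≡upper : lowerRow n P x ≡ upperRow n P x
    lower≡upper = begin
      lowerRow n P x        ≡⟨ sym (step-early ex) ⟩
      f x                   ≡⟨ fx≡fy ⟩
      f y                   ≡⟨ step-late ly ⟩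
      upperRow n P (N ∸ y)  ≡⟨ cong (upperRow n P) (sym (same-target (inj₁ ex) (inj₂ ly) fx≡fy)) ⟩
      upperRow n P x        ∎

  step-injective : ∀ {x y} → Moving x → Moving y → f x ≡ f y → x ≡ y
  step-injective mx@(inj₁ _)  my@(inj₁ _)  fx≡fy = same-target mx my fx≡fy
  step-injective mx@(inj₂ lx) my@(inj₂ ly) fx≡fy =
    ∸-cancelˡ-≡ (<⇒≤ (proj₂ lx)) (<⇒≤ (proj₂ ly)) (same-target mx my fx≡fy)
  step-injective (inj₁ ex) (inj₂ ly) fx≡fy = contradiction fx≡fy (early-late-apart ex ly)
  step-injective (inj₂ lx) (inj₁ ey) fx≡fy = contradiction (sym fx≡fy) (early-late-apart ey lx)

  -- Every occupied row is hit: a point (c : u) of a full column is its lower point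
  -- (reached from row c) or its upper point (reached from row 2n - c).
  step-onto : ∀ {u} → Occupied u → ∃ λ x → Moving x × f x ≡ u
  step-onto {u} (c , early , pcu) with TwoPointColumn.only-points (column early) (proj₂ (in-grid c u pcu)) pcu
  ... | inj₁ u≡lower = c , inj₁ early , trans (step-early early) (sym u≡lower)
  ... | inj₂ u≡upper = N ∸ c , inj₂ (column-late early) ,
    trans (step-late (column-late early))
          (trans (cong (upperRow n P) (m∸[m∸n]≡n (early≤N early))) (sym u≡upper))

  open PartialBijection N f moving? occupied? moving-range occupied-range
                        step-injective step-into step-onto step-still public

  -- Every early row is occupied: its unique point lies in a column ≤ the row < j.
  early-row-occupied : ∀ {r} → Early r → Occupied r
  early-row-occupied {r} (1≤r , r<j) =
    let one , left-of-diagonal = early-rows r 1≤r r<j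
        c , (1≤c , _) , pcr = count-witness (λ d → P d r) n (≤-reflexive (sym one))
    in  c , (1≤c , ≤-<-trans (left-of-diagonal c pcr) r<j) , pcr

  I⇒source : ∀ {i} → InI n j P i → Source i
  I⇒source ((j≤i , i≤N) , empty) =
    (≤-trans 1≤j j≤i , i≤N) ,
    λ (c , (1≤c , c<j) , pci) → contradiction (trans (sym pci) (empty c 1≤c c<j)) λ ()

  source⇒I : ∀ {i} → Source i → InI n j P i
  source⇒I {i} ((1≤i , i≤N) , free) = (j≤i , i≤N) , empty
    where
    j≤i : j ≤ i
    j≤i with j ≤? i
    ... | yes j≤i = j≤i
    ... | no  j≰i = contradiction (early-row-occupied (1≤i , ≰⇒> j≰i)) free

    empty : ∀ c → 1 ≤ c → c < j → P c i ≡ false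
    empty c 1≤c c<j with P c i in pci
    ... | true  = contradiction (c , (1≤c , c<j) , pci) free
    ... | false = refl

  roots⇒sink : ∀ {r} → InRoots n j r → Sink r
  roots⇒sink (inj₁ (j≤r , r≤N∸j)) = (≤-trans 1≤j j≤r , ≤-trans r≤N∸j (m∸n≤m N j)) , λ where
    (inj₁ (_ , r<j))     → <⇒≱ r<j j≤r
    (inj₂ (N∸j<r , _))   → <⇒≱ N∸j<r r≤N∸j
  roots⇒sink (inj₂ refl) = (≤-trans 1≤j j≤N , ≤-refl) , λ where
    (inj₁ (_ , N<j))     → <⇒≱ N<j j≤N
    (inj₂ (_ , N<N))     → <-irrefl refl N<N

  sink⇒roots : ∀ {r} → Sink r → InRoots n j r
  sink⇒roots {r} ((1≤r , r≤N) , still) with j ≤? r | r ≤? N ∸ j | m≤n⇒m<n∨m≡n r≤N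
  ... | no  j≰r | _         | _        = contradiction (inj₁ (1≤r , ≰⇒> j≰r)) still
  ... | yes j≤r | yes r≤N∸j | _        = inj₁ (j≤r , r≤N∸j)
  ... | yes _   | no  r≰N∸j | inj₁ r<N = contradiction (inj₂ (≰⇒> r≰N∸j , r<N)) still
  ... | yes _   | no  _     | inj₂ r≡N = inj₂ r≡N

proposition1 : (n j : ℕ) → 1 ≤ n → 1 ≤ j → j ≤ n → (P : Placement) → Hyp n j P →
    Σ (ℕ → ℕ) (λ root →
      (∀ i → InI n j P i →
        InRoots n j (root i) × ∃ (λ K → ∀ k → K ≤ k → seqI n j P i k ≡ root i))
      × (∀ i i' → InI n j P i → InI n j P i' → root i ≡ root i' → i ≡ i')
      × (∀ r → InRoots n j r → ∃ (λ i → InI n j P i × root i ≡ r)))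
proposition1 n j _ 1≤j j≤n P hyp =
    root
  , (λ i i∈I → sink⇒roots (root-sink (I⇒source i∈I)) , N , root-settles (I⇒source i∈I))
  , (λ i i' i∈I i'∈I → root-injective (I⇒source i∈I) (I⇒source i'∈I))
  , (λ r r∈roots → let i , source , root≡r = root-onto (roots⇒sink r∈roots)
                   in  i , source⇒I source , root≡r)
  where open Tableau n j 1≤j j≤n P hyp
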